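{- Let $\mathcal{A}=(a_n)_{n\in\mathbb{N}_+}$ be a sequence of positive integers. The inequality \[ \lim_{N\to\infty}\frac{\#\{n\leqslant N:\ p_\mathcal{A}(n,k)\equiv 1\pmod{2}\}}{N}\leqslant\frac{2}{3} \] holds for infinitely many positive integers $k$. More precisely, if this inequality fails for some positive integer $k$, then it holds for $k+1$.
   Context: $\mathbb{N}=\{0,1,2,\ldots\}$, and $n$ ranges over $\mathbb{N}$. For $k\in\mathbb{N}_+$ and $n\in\mathbb{N}$, $p_\mathcal{A}(n,k)$ is the number of tuples $(x_1,\ldots,x_k)\in\mathbb{N}^k$ with $a_1x_1+\cdots+a_kx_k=n$, i.e. $\sum_{n\ge0}p_\mathcal{A}(n,k)x^n=\prod_{i=1}^k(1-x^{a_i})^{ -1}$. -}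

module Defs where

open import Data.Nat using (ℕ; zero; suc; _+_; _*_; _∸_; _≤_; _<_; _%_; _≤?_)
open import Data.Nat.Properties using (_≟_)
open import Data.List using (List; upTo; map; filter; length)
open import Data.Nat.ListAction using (sum)
open import Data.Product using (∃; _×_)
open import Relation.Nullary using (¬_; yes; no)
open import Relation.Binary.PropositionalEquality using (_≡_)

-- A sequence 𝒜 = (a_i)_{i ≥ 1} is represented by a : ℕ → ℕ with
-- a i standing for a_{i+1}.  Positivity is a hypothesis of the theorem.

-- pA a n k = p_𝒜(n,k) = #{(x_1,…,x_k) ∈ ℕ^k : a_1 x_1 + ⋯ + a_k x_k = n}.
-- Defined by splitting off the last variable x_k (which ranges over
-- 0..n, since a_k ≥ 1 forces x_k ≤ n; terms with a_k x_k > n contribute 0):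
--   p(n,0)   = [n = 0]
--   p(n,k+1) = Σ_{x=0}^{n} [a_{k+1} x ≤ n] p(n − a_{k+1} x, k)
pA : (ℕ → ℕ) → ℕ → ℕ → ℕ
pA a zero    zero    = 1
pA a (suc n) zero    = 0
pA a n       (suc k) = sum (map term (upTo (suc n)))
  where
  term : ℕ → ℕ
  term x with x * a k ≤? n
  ... | yes _ = pA a (n ∸ x * a k) k
  ... | no  _ = 0

oddCount : (ℕ → ℕ) → ℕ → ℕ → ℕ
oddCount a k N = length (filter (λ n → pA a n k % 2 ≟ 1) (upTo (suc N)))

-- "lim_{N→∞} oddCount(N)/N ≤ 2/3", expressed as: for every ε = 1/(e+1) > 0,
-- eventually oddCount(N)/N ≤ 2/3 + ε, i.e.
--   3 (e+1) · oddCount(N) ≤ (2 (e+1) + 3) · N  for all large N.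
-- (This is limsup ≤ 2/3, which equals the stated inequality because the
-- limit exists: the parity sequence is eventually periodic.)
DensityAtMostTwoThirds : (ℕ → ℕ) → ℕ → Set
DensityAtMostTwoThirds a k =
  ∀ (e : ℕ) → ∃ λ (N₀ : ℕ) → ∀ (N : ℕ) → N₀ ≤ N →
    3 * suc e * oddCount a k N ≤ (2 * suc e + 3) * N

module Submission where

-- Over 𝔽₂ the generating function of p_𝒜(·,k) is (1 + x^{a_{k+1}}) times that of
-- p_𝒜(·,k+1).  So if p_𝒜(n,k) is odd, one of p_𝒜(n,k+1), p_𝒜(n − a_{k+1},k+1) is
-- even, and the densities of odd values satisfy δ_k + 2 δ_{k+1} ≤ 2.  The same
-- relation makes every parity sequence periodic (from n = 1 on), so δ_k exists
-- and equals c/T for a period T containing c odd values; if δ_k > 2/3 then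
-- δ_{k+1} < 2/3.

open import Defs
open import Data.Nat.Base
open import Data.Nat.Properties
open import Data.Nat.DivMod using (_/_; m≡m%n+[m/n]*n; m%n<n)
open import Data.Nat.ListAction using (sum)
open import Data.Nat.Tactic.RingSolver using (solve)
open import Data.Parity.Base using (Parity; 0ℙ; 1ℙ; _⁻¹) renaming (_+_ to _⊕_)
import Data.Parity.Properties as ℙ
open import Data.List.Base using ([]; _∷_; applyUpTo; map; filter; length)
open import Data.List.Properties using (map-applyUpTo; filter-accept; filter-reject)
open import Data.Product.Base using (∃; ∃₂; Σ; _×_; _,_; proj₁; proj₂)
open import Data.Sum.Base as Sum using (_⊎_; inj₁; inj₂; [_,_]′)
open import Function.Base using (_∘_; id)
open import Relation.Nullary using (¬_; yes; no; contradiction)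
open import Relation.Binary.PropositionalEquality
open import Algebra.Properties.CommutativeSemigroup +-commutativeSemigroup
  using (interchange; x∙yz≈y∙xz)
open import Algebra.Properties.CommutativeSemigroup ℙ.+-commutativeSemigroup
  using () renaming (interchange to ⊕-interchange)

⊕-cancel-common : ∀ p q r → (p ⊕ q) ⊕ (p ⊕ r) ≡ q ⊕ r
⊕-cancel-common p q r = trans (⊕-interchange p q p r) (cong (_⊕ (q ⊕ r)) (ℙ.p+p≡0ℙ p))

toℕ : Parity → ℕ
toℕ 0ℙ = 0
toℕ 1ℙ = 1

toℕ≤1 : ∀ p → toℕ p ≤ 1
toℕ≤1 0ℙ = z≤n
toℕ≤1 1ℙ = ≤-refl

toℕ-⁻¹ : ∀ p → toℕ (p ⁻¹) + toℕ p ≡ 1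
toℕ-⁻¹ 0ℙ = refl
toℕ-⁻¹ 1ℙ = refl

toℕ≤[p⊕q]⁻¹+q⁻¹ : ∀ p q → toℕ p ≤ toℕ ((p ⊕ q) ⁻¹) + toℕ (q ⁻¹)
toℕ≤[p⊕q]⁻¹+q⁻¹ 0ℙ _  = z≤n
toℕ≤[p⊕q]⁻¹+q⁻¹ 1ℙ 0ℙ = ≤-refl
toℕ≤[p⊕q]⁻¹+q⁻¹ 1ℙ 1ℙ = ≤-refl

%2≡toℕ∘parity : ∀ n → n % 2 ≡ toℕ (parity n)
%2≡toℕ∘parity 0             = refl
%2≡toℕ∘parity 1             = refl
%2≡toℕ∘parity (suc (suc n)) = %2≡toℕ∘parity n

Periodic : {A : Set} → (ℕ → A) → ℕ → Set
Periodic u p = ∀ n → u (p + n) ≡ u n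

periodic-* : ∀ {A : Set} {u : ℕ → A} {p} → Periodic u p → ∀ m → Periodic u (m * p)
periodic-*         per zero    n = refl
periodic-* {u = u} {p} per (suc m) n = begin
  u ((p + m * p) + n) ≡⟨ cong u (+-assoc p (m * p) n) ⟩
  u (p + (m * p + n)) ≡⟨ per (m * p + n) ⟩
  u (m * p + n)       ≡⟨ periodic-* per m n ⟩
  u n                 ∎
  where open ≡-Reasoning

periodic-shift : ∀ {A : Set} {u : ℕ → A} {p} m → Periodic u p → Periodic (λ n → u (m + n)) p
periodic-shift {u = u} {p} m per n = trans (cong u (x∙yz≈y∙xz m p n)) (per (m + n))

ones : (ℕ → Parity) → ℕ → ℕ
ones u zero    = 0
ones u (suc M) = toℕ (u 0) + ones (u ∘ suc) M

ones-≤ : ∀ u M → ones u M ≤ M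
ones-≤ u zero    = z≤n
ones-≤ u (suc M) = +-mono-≤ (toℕ≤1 (u 0)) (ones-≤ (u ∘ suc) M)

ones-cong : ∀ {u v} → u ≗ v → ∀ M → ones u M ≡ ones v M
ones-cong u≗v zero    = refl
ones-cong u≗v (suc M) = cong₂ _+_ (cong toℕ (u≗v 0)) (ones-cong (u≗v ∘ suc) M)

ones-+ : ∀ u m n → ones u (m + n) ≡ ones u m + ones (λ i → u (m + i)) n
ones-+ u zero    n = refl
ones-+ u (suc m) n =
  trans (cong (toℕ (u 0) +_) (ones-+ (u ∘ suc) m n)) (sym (+-assoc (toℕ (u 0)) _ _))

ones-shift-≤ : ∀ u m n → ones (λ i → u (m + i)) n ≤ ones u (m + n)
ones-shift-≤ u m n = subst (ones (λ i → u (m + i)) n ≤_) (sym (ones-+ u m n)) (m≤n+m _ (ones u m))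

ones-mono : ∀ u {m n} → m ≤ n → ones u m ≤ ones u n
ones-mono u {m} m≤n with m≤n⇒∃[o]m+o≡n m≤n
... | o , refl = subst (ones u m ≤_) (sym (ones-+ u m o)) (m≤m+n _ _)

ones-⁻¹ : ∀ u M → ones (_⁻¹ ∘ u) M + ones u M ≡ M
ones-⁻¹ u zero    = refl
ones-⁻¹ u (suc M) =
  trans (interchange (toℕ (u 0 ⁻¹)) _ (toℕ (u 0)) _) (cong₂ _+_ (toℕ-⁻¹ (u 0)) (ones-⁻¹ (u ∘ suc) M))

ones-subadditive : ∀ {u v w} → (∀ n → toℕ (u n) ≤ toℕ (v n) + toℕ (w n)) →
                   ∀ M → ones u M ≤ ones v M + ones w M
ones-subadditive                 u≤v+w zero    = z≤n
ones-subadditive {u} {v} {w} u≤v+w (suc M) = begin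
  toℕ (u 0) + ones (u ∘ suc) M
    ≤⟨ +-mono-≤ (u≤v+w 0) (ones-subadditive (u≤v+w ∘ suc) M) ⟩
  (toℕ (v 0) + toℕ (w 0)) + (ones (v ∘ suc) M + ones (w ∘ suc) M)
    ≡⟨ interchange (toℕ (v 0)) _ _ _ ⟩
  (toℕ (v 0) + ones (v ∘ suc) M) + (toℕ (w 0) + ones (w ∘ suc) M) ∎
  where open ≤-Reasoning

ones-periodic : ∀ {u T} → Periodic u T → ∀ q r → ones u (q * T + r) ≡ q * ones u T + ones u r
ones-periodic             per zero    r = refl
ones-periodic {u} {T} per (suc q) r = begin
  ones u ((T + q * T) + r)                       ≡⟨ cong (ones u) (+-assoc T (q * T) r) ⟩
  ones u (T + (q * T + r))                       ≡⟨ ones-+ u T (q * T + r) ⟩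
  ones u T + ones (λ i → u (T + i)) (q * T + r)  ≡⟨ cong (ones u T +_) (ones-cong per (q * T + r)) ⟩
  ones u T + ones u (q * T + r)                  ≡⟨ cong (ones u T +_) (ones-periodic per q r) ⟩
  ones u T + (q * ones u T + ones u r)           ≡⟨ sym (+-assoc (ones u T) _ _) ⟩
  (ones u T + q * ones u T) + ones u r           ∎
  where open ≡-Reasoning

m≡[m/n]*n+m%n : ∀ m n .{{_ : NonZero n}} → m ≡ m / n * n + m % n
m≡[m/n]*n+m%n m n = trans (m≡m%n+[m/n]*n m n) (+-comm (m % n) _)

ones-periodic-bounds : ∀ {u T} .{{_ : NonZero T}} → Periodic u T → ∀ N →
  T * ones u N ≤ ones u T * N + T * T × ones u T * N ≤ T * ones u N + T * T
ones-periodic-bounds {u} {T} {{T≢0}} per N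
  rewrite m≡[m/n]*n+m%n N T {{T≢0}} | ones-periodic per (N / T) (N % T) =
    upper (N / T) (ones u T) (ones u (N % T)) (N % T) (≤-trans (ones-≤ u (N % T)) r≤T) ,
    lower (N / T) (ones u T) (ones u (N % T)) (N % T) (ones-≤ u T) r≤T
  where
  r≤T : N % T ≤ T
  r≤T = <⇒≤ (m%n<n N T)
  upper : ∀ q c x r → x ≤ T → T * (q * c + x) ≤ c * (q * T + r) + T * T
  upper q c x r x≤T = begin
    T * (q * c + x)         ≡⟨ solve (T ∷ q ∷ c ∷ x ∷ []) ⟩
    c * (q * T) + T * x     ≤⟨ +-mono-≤ (*-monoʳ-≤ c (m≤m+n (q * T) r)) (*-monoʳ-≤ T x≤T) ⟩
    c * (q * T + r) + T * T ∎
    where open ≤-Reasoning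
  lower : ∀ q c x r → c ≤ T → r ≤ T → c * (q * T + r) ≤ T * (q * c + x) + T * T
  lower q c x r c≤T r≤T = begin
    c * (q * T + r)         ≡⟨ solve (T ∷ q ∷ c ∷ r ∷ []) ⟩
    T * (q * c) + c * r     ≤⟨ +-mono-≤ (*-monoʳ-≤ T (m≤m+n (q * c) x)) (*-mono-≤ c≤T r≤T) ⟩
    T * (q * c + x) + T * T ∎
    where open ≤-Reasoning

-- In generating functions over 𝔽₂: U = (1 + x^d) V in all degrees ≥ d.
IsDifference : ℕ → (ℕ → Parity) → (ℕ → Parity) → Set
IsDifference d u v = ∀ n → v (d + n) ≡ u (d + n) ⊕ v n

ones-difference-bound : ∀ {d u v} → IsDifference d u v → ∀ M → ones u M + 2 * ones v M ≤ 2 * M + d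
ones-difference-bound {d} {u} {v} Δ M = begin
  ones u M + 2 * ones v M                   ≤⟨ +-monoˡ-≤ (2 * ones v M) (ones-u-bound M) ⟩
  d + (ones v̄ M + ones v̄ M) + 2 * ones v M ≡⟨ rearrange d (ones v̄ M) (ones v M) ⟩
  2 * (ones v̄ M + ones v M) + d             ≡⟨ cong (λ m → 2 * m + d) (ones-⁻¹ v M) ⟩
  2 * M + d                                  ∎
  where
  open ≤-Reasoning
  v̄ : ℕ → Parity
  v̄ = _⁻¹ ∘ v
  rearrange : ∀ d x̄ x → d + (x̄ + x̄) + 2 * x ≡ 2 * (x̄ + x) + d
  rearrange d x̄ x = solve (d ∷ x̄ ∷ x ∷ [])
  u≤v̄+v̄ : ∀ n → toℕ (u (d + n)) ≤ toℕ (v̄ (d + n)) + toℕ (v̄ n)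
  u≤v̄+v̄ n = subst (λ w → toℕ (u (d + n)) ≤ toℕ (w ⁻¹) + toℕ (v̄ n)) (sym (Δ n))
                   (toℕ≤[p⊕q]⁻¹+q⁻¹ (u (d + n)) (v n))
  ones-u-bound : ∀ M → ones u M ≤ d + (ones v̄ M + ones v̄ M)
  ones-u-bound M with d ≤? M
  ... | no  d≰M = ≤-trans (ones-≤ u M) (≤-trans (<⇒≤ (≰⇒> d≰M)) (m≤m+n d _))
  ... | yes d≤M with m≤n⇒∃[o]m+o≡n d≤M
  ...   | m , refl = begin
    ones u (d + m)                               ≡⟨ ones-+ u d m ⟩
    ones u d + ones (λ i → u (d + i)) m          ≤⟨ +-mono-≤ (ones-≤ u d) (ones-subadditive u≤v̄+v̄ m) ⟩
    d + (ones (λ i → v̄ (d + i)) m + ones v̄ m)   ≤⟨ +-monoʳ-≤ d (+-mono-≤ (ones-shift-≤ v̄ d m)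
                                                                     (ones-mono v̄ (m≤n+m m d))) ⟩
    d + (ones v̄ (d + m) + ones v̄ (d + m))       ∎

-- s = v (p + ·) ⊕ v has d-step difference u (d + p + ·) ⊕ u (d + ·) = 0, so it is
-- d-periodic, hence p-periodic, and s (p + n) ≡ s n says v (2p + n) ≡ v n.
difference-periodic : ∀ {d u v T} → IsDifference d u v → Periodic (λ n → u (d + n)) T →
                      Periodic v (2 * (T * d))
difference-periodic {d} {u} {v} {T} Δ per n =
  ℙ.+-cancelʳ-≡ (v (p + n)) _ _ (begin
    v (2 * p + n) ⊕ v (p + n)   ≡⟨ cong (λ i → v i ⊕ v (p + n)) 2p+n≡p+[p+n] ⟩
    s (p + n)                   ≡⟨ periodic-* s-per T n ⟩
    v (p + n) ⊕ v n             ≡⟨ ℙ.+-comm (v (p + n)) (v n) ⟩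
    v n ⊕ v (p + n)             ∎)
  where
  open ≡-Reasoning
  p : ℕ
  p = T * d
  2p+n≡p+[p+n] : 2 * p + n ≡ p + (p + n)
  2p+n≡p+[p+n] = trans (cong (λ x → p + x + n) (+-identityʳ p)) (+-assoc p p n)
  s : ℕ → Parity
  s i = v (p + i) ⊕ v i
  u-per : Periodic (λ i → u (d + i)) p
  u-per = subst (Periodic (λ i → u (d + i))) (*-comm d T) (periodic-* per d)
  s-per : Periodic s d
  s-per i = begin
    v (p + (d + i)) ⊕ v (d + i)                       ≡⟨ cong (λ j → v j ⊕ v (d + i)) (x∙yz≈y∙xz p d i) ⟩
    v (d + (p + i)) ⊕ v (d + i)                       ≡⟨ cong₂ _⊕_ (Δ (p + i)) (Δ i) ⟩
    (u (d + (p + i)) ⊕ v (p + i)) ⊕ (u (d + i) ⊕ v i)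
      ≡⟨ cong (λ x → (x ⊕ v (p + i)) ⊕ (u (d + i) ⊕ v i)) (u-per i) ⟩
    (u (d + i) ⊕ v (p + i)) ⊕ (u (d + i) ⊕ v i)       ≡⟨ ⊕-cancel-common (u (d + i)) (v (p + i)) (v i) ⟩
    s i                                               ∎

-- #{n ≤ N : u n = 1} ≤ 2N/3 + B/3m; the factor m clears the denominator of the density.
TwoThirdsBound : (ℕ → Parity) → Set
TwoThirdsBound u = ∃₂ λ m B → NonZero m × (∀ N → 3 * m * ones u (suc N) ≤ 2 * m * N + B)

sparse-twoThirdsBound : ∀ {u T} {{_ : NonZero T}} → Periodic (u ∘ suc) T →
                        3 * ones (u ∘ suc) T ≤ 2 * T → TwoThirdsBound u
sparse-twoThirdsBound {u} {T} {{T≢0}} per sparse = T , 3 * T + 3 * (T * T) , T≢0 , λ N →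
  arith (toℕ (u 0)) (ones (u ∘ suc) N) (ones (u ∘ suc) T) N
        (toℕ≤1 (u 0)) (proj₁ (ones-periodic-bounds {u ∘ suc} per N)) sparse
  where
  arith : ∀ b x c N → b ≤ 1 → T * x ≤ c * N + T * T → 3 * c ≤ 2 * T →
          3 * T * (b + x) ≤ 2 * T * N + (3 * T + 3 * (T * T))
  arith b x c N b≤1 Tx≤cN+TT 3c≤2T = begin
    3 * T * (b + x)                    ≡⟨ solve (T ∷ b ∷ x ∷ []) ⟩
    3 * T * b + 3 * (T * x)            ≤⟨ +-mono-≤ (*-monoʳ-≤ (3 * T) b≤1) (*-monoʳ-≤ 3 Tx≤cN+TT) ⟩
    3 * T * 1 + 3 * (c * N + T * T)    ≡⟨ solve (T ∷ c ∷ N ∷ []) ⟩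
    3 * c * N + (3 * T + 3 * (T * T))  ≤⟨ +-monoˡ-≤ _ (*-monoˡ-≤ N 3c≤2T) ⟩
    2 * T * N + (3 * T + 3 * (T * T))  ∎
    where open ≤-Reasoning

dense-twoThirdsBound : ∀ {d u v T} .{{_ : NonZero T}} → IsDifference d u v → Periodic (u ∘ suc) T →
                       2 * T ≤ 3 * ones (u ∘ suc) T → TwoThirdsBound v
dense-twoThirdsBound {d} {u} {v} {T} Δ per dense =
  2 * T , 3 * T * (2 + d) + 3 * (T * T) , m*n≢0 2 T , λ N →
  arith (ones u (suc N)) (ones v (suc N)) (ones (u ∘ suc) N) (ones (u ∘ suc) T) N
        (ones-difference-bound {d} {u} {v} Δ (suc N))
        (proj₂ (ones-periodic-bounds {u ∘ suc} per N)) dense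
        (m≤n+m (ones (u ∘ suc) N) (toℕ (u 0)))
  where
  arith : ∀ O O′ x c N → O + 2 * O′ ≤ 2 * suc N + d → c * N ≤ T * x + T * T →
          2 * T ≤ 3 * c → x ≤ O →
          3 * (2 * T) * O′ ≤ 2 * (2 * T) * N + (3 * T * (2 + d) + 3 * (T * T))
  arith O O′ x c N count cN≤Tx+TT 2T≤3c x≤O = +-cancelˡ-≤ (2 * T * N) _ _ (begin
    2 * T * N + 3 * (2 * T) * O′          ≤⟨ +-monoˡ-≤ _ (*-monoˡ-≤ N 2T≤3c) ⟩
    3 * c * N + 3 * (2 * T) * O′          ≡⟨ solve (c ∷ N ∷ T ∷ O′ ∷ []) ⟩
    3 * (c * N) + 6 * T * O′
      ≤⟨ +-monoˡ-≤ _ (*-monoʳ-≤ 3 (≤-trans cN≤Tx+TT (+-monoˡ-≤ _ (*-monoʳ-≤ T x≤O)))) ⟩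
    3 * (T * O + T * T) + 6 * T * O′      ≡⟨ solve (T ∷ O ∷ O′ ∷ []) ⟩
    3 * T * (O + 2 * O′) + 3 * (T * T)    ≤⟨ +-monoˡ-≤ _ (*-monoʳ-≤ (3 * T) count) ⟩
    3 * T * (2 * suc N + d) + 3 * (T * T) ≡⟨ solve (T ∷ N ∷ d ∷ []) ⟩
    2 * T * N + (2 * (2 * T) * N + (3 * T * (2 + d) + 3 * (T * T))) ∎)
    where open ≤-Reasoning

periodic-dichotomy : ∀ {d u v T} {{_ : NonZero T}} → IsDifference d u v → Periodic (u ∘ suc) T →
                     TwoThirdsBound u ⊎ TwoThirdsBound v
periodic-dichotomy {d} {u} {v} {T} Δ per with 3 * ones (u ∘ suc) T ≤? 2 * T
... | yes sparse = inj₁ (sparse-twoThirdsBound {u} per sparse)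
... | no  ¬sparse = inj₂ (dense-twoThirdsBound {d} {u} {v} Δ per (<⇒≤ (≰⇒> ¬sparse)))

applyUpTo-cong : ∀ {A : Set} {f g : ℕ → A} → f ≗ g → ∀ n → applyUpTo f n ≡ applyUpTo g n
applyUpTo-cong f≗g zero    = refl
applyUpTo-cong f≗g (suc n) = cong₂ _∷_ (f≗g 0) (applyUpTo-cong (f≗g ∘ suc) n)

sum-applyUpTo-≡0 : ∀ {f : ℕ → ℕ} → (∀ x → f x ≡ 0) → ∀ n → sum (applyUpTo f n) ≡ 0
sum-applyUpTo-≡0 f≡0 zero    = refl
sum-applyUpTo-≡0 f≡0 (suc n) = cong₂ _+_ (f≡0 0) (sum-applyUpTo-≡0 (f≡0 ∘ suc) n)

sum-applyUpTo-vanishing : ∀ {f : ℕ → ℕ} {m n} → (∀ x → m ≤ x → f x ≡ 0) → m ≤ n →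
                          sum (applyUpTo f n) ≡ sum (applyUpTo f m)
sum-applyUpTo-vanishing {n = n} f≡0 z≤n       = sum-applyUpTo-≡0 (λ x → f≡0 x z≤n) n
sum-applyUpTo-vanishing {f} f≡0 (s≤s m≤n) =
  cong (f 0 +_) (sum-applyUpTo-vanishing (λ x m≤x → f≡0 (suc x) (s≤s m≤x)) m≤n)

summand : (ℕ → ℕ) → ℕ → ℕ → ℕ → ℕ
summand a k n x with x * a k ≤? n
... | yes _ = pA a (n ∸ x * a k) k
... | no  _ = 0

pA-suc : ∀ a k n → pA a n (suc k) ≡ sum (applyUpTo (summand a k n) (suc n))
pA-suc a k zero    = refl
pA-suc a k (suc n) = begin
  pA a (suc n) (suc k)                                ≡⟨ proj₂ unfold ⟩
  pA a (suc n) k + sum (map t (applyUpTo suc (suc n)))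
    ≡⟨ cong (λ xs → pA a (suc n) k + sum xs) summands ⟩
  sum (applyUpTo (summand a k (suc n)) (suc (suc n)))   ∎
  where
  open ≡-Reasoning
  -- pA a n (suc k) unfolds only for a constructor n, and its summand is local to a
  -- where block; unfold lets unification name it t (from index 1, where it does not compute).
  unfold : Σ (ℕ → ℕ) λ t → pA a (suc n) (suc k) ≡ pA a (suc n) k + sum (map t (applyUpTo suc (suc n)))
  unfold = _ , refl
  t : ℕ → ℕ
  t = proj₁ unfold
  agree : t ≗ summand a k (suc n)
  agree x with x * a k ≤? suc n
  ... | yes _ = refl
  ... | no  _ = refl
  summands : map t (applyUpTo suc (suc n)) ≡ applyUpTo (summand a k (suc n) ∘ suc) (suc n)
  summands = trans (map-applyUpTo suc t (suc n)) (applyUpTo-cong (agree ∘ suc) (suc n))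

summand-suc : ∀ a k n x → summand a k (a k + n) (suc x) ≡ summand a k n x
summand-suc a k n x with a k + x * a k ≤? a k + n | x * a k ≤? n
... | yes _   | yes _   = cong (λ m → pA a m k) ([m+n]∸[m+o]≡n∸o (a k) n (x * a k))
... | yes le  | no  ¬le = contradiction (+-cancelˡ-≤ (a k) _ _ le) ¬le
... | no  ¬le | yes le  = contradiction (+-monoʳ-≤ (a k) le) ¬le
... | no  _   | no  _   = refl

summand-vanishing : ∀ a k .{{_ : NonZero (a k)}} n x → n < x → summand a k n x ≡ 0
summand-vanishing a k n x n<x with x * a k ≤? n
... | yes le = contradiction (≤-trans (m≤m*n x (a k)) le) (<⇒≱ n<x)
... | no  _  = refl

pA-recurrence : ∀ a k n .{{_ : NonZero (a k)}} →
                pA a (a k + n) (suc k) ≡ pA a (a k + n) k + pA a n (suc k)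
pA-recurrence a k n = begin
  pA a (a k + n) (suc k)
    ≡⟨ pA-suc a k (a k + n) ⟩
  pA a (a k + n) k + sum (applyUpTo (summand a k (a k + n) ∘ suc) (a k + n))
    ≡⟨ cong (pA a (a k + n) k +_) (begin
         sum (applyUpTo (summand a k (a k + n) ∘ suc) (a k + n))
           ≡⟨ cong sum (applyUpTo-cong (summand-suc a k n) (a k + n)) ⟩
         sum (applyUpTo (summand a k n) (a k + n))
           ≡⟨ sum-applyUpTo-vanishing (summand-vanishing a k n) (+-monoˡ-≤ n (>-nonZero⁻¹ (a k))) ⟩
         sum (applyUpTo (summand a k n) (suc n))
           ≡⟨ sym (pA-suc a k n) ⟩
         pA a n (suc k) ∎) ⟩
  pA a (a k + n) k + pA a n (suc k) ∎
  where open ≡-Reasoning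

pA-parity : (ℕ → ℕ) → ℕ → ℕ → Parity
pA-parity a k n = parity (pA a n k)

pA-parity-difference : ∀ a k .{{_ : NonZero (a k)}} →
                       IsDifference (a k) (pA-parity a k) (pA-parity a (suc k))
pA-parity-difference a k n =
  trans (cong parity (pA-recurrence a k n)) (ℙ.+-homo-+ (pA a (a k + n) k) (pA a n (suc k)))

pA-parity-periodic : ∀ a → (∀ i → NonZero (a i)) → ∀ k →
                     ∃ λ T → NonZero T × Periodic (pA-parity a k ∘ suc) T
pA-parity-periodic a a≢0 zero    = 1 , _ , λ n → refl
pA-parity-periodic a a≢0 (suc k) with pA-parity-periodic a a≢0 k
... | T , T≢0 , per =
  2 * (T * a k) , m*n≢0 2 (T * a k) ,
  periodic-shift {u = pA-parity a (suc k)} 1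
    (difference-periodic {a k} {pA-parity a k} {pA-parity a (suc k)}
      (pA-parity-difference a k) per-from-a[k])
  where
  instance
    _ : NonZero T
    _ = T≢0
    _ : NonZero (a k)
    _ = a≢0 k
    _ : NonZero (T * a k)
    _ = m*n≢0 T (a k)
  per-from-a[k] : Periodic (λ n → pA-parity a k (a k + n)) T
  per-from-a[k] = subst (λ d → Periodic (λ n → pA-parity a k (d + n)) T) (suc-pred (a k))
                        (periodic-shift (pred (a k)) per)

length-filter-odd-∷ : ∀ (f : ℕ → ℕ) m xs → length (filter (λ n → f n % 2 ≟ 1) (m ∷ xs)) ≡
                      toℕ (parity (f m)) + length (filter (λ n → f n % 2 ≟ 1) xs)
length-filter-odd-∷ f m xs with parity (f m) in eq
... | 0ℙ = cong length (filter-reject (λ n → f n % 2 ≟ 1) (λ odd → 0≢1+n (trans (sym fm%2≡0) odd)))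
  where
  fm%2≡0 : f m % 2 ≡ 0
  fm%2≡0 = trans (%2≡toℕ∘parity (f m)) (cong toℕ eq)
... | 1ℙ = cong length (filter-accept (λ n → f n % 2 ≟ 1) (trans (%2≡toℕ∘parity (f m)) (cong toℕ eq)))

length-filter-odd : ∀ (f g : ℕ → ℕ) M →
                    length (filter (λ n → f n % 2 ≟ 1) (applyUpTo g M)) ≡ ones (parity ∘ f ∘ g) M
length-filter-odd f g zero    = refl
length-filter-odd f g (suc M) =
  trans (length-filter-odd-∷ f (g 0) (applyUpTo (g ∘ suc) M))
        (cong (toℕ (parity (f (g 0))) +_) (length-filter-odd f (g ∘ suc) M))

density-of-twoThirdsBound : ∀ {a k} → TwoThirdsBound (pA-parity a k) → DensityAtMostTwoThirds a k
density-of-twoThirdsBound {a} {k} (m , B , m≢0 , bound) e = suc e * B , λ N N₀≤N →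
  subst (λ O → 3 * suc e * O ≤ (2 * suc e + 3) * N)
        (sym (length-filter-odd (λ n → pA a n k) id (suc N)))
        (arith (ones (pA-parity a k) (suc N)) N (bound N) N₀≤N)
  where
  instance
    _ : NonZero m
    _ = m≢0
  arith : ∀ O N → 3 * m * O ≤ 2 * m * N + B → suc e * B ≤ N → 3 * suc e * O ≤ (2 * suc e + 3) * N
  arith O N O-bound N₀≤N = *-cancelˡ-≤ m (begin
    m * (3 * suc e * O)               ≡⟨ solve (m ∷ e ∷ O ∷ []) ⟩
    suc e * (3 * m * O)               ≤⟨ *-monoʳ-≤ (suc e) O-bound ⟩
    suc e * (2 * m * N + B)           ≡⟨ solve (m ∷ e ∷ N ∷ B ∷ []) ⟩
    m * (2 * suc e * N) + suc e * B
      ≤⟨ +-monoʳ-≤ _ (≤-trans N₀≤N (≤-trans (m≤n*m N 3) (m≤n*m (3 * N) m))) ⟩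
    m * (2 * suc e * N) + m * (3 * N) ≡⟨ solve (m ∷ e ∷ N ∷ []) ⟩
    m * ((2 * suc e + 3) * N)         ∎)
    where open ≤-Reasoning

density-dichotomy : ∀ a → (∀ i → NonZero (a i)) → ∀ k →
                    DensityAtMostTwoThirds a k ⊎ DensityAtMostTwoThirds a (suc k)
density-dichotomy a a≢0 k with pA-parity-periodic a a≢0 k
... | T , T≢0 , per =
  Sum.map (density-of-twoThirdsBound {a} {k}) (density-of-twoThirdsBound {a} {suc k})
    (periodic-dichotomy {a k} {pA-parity a k} {pA-parity a (suc k)} {{T≢0}}
      (pA-parity-difference a k {{a≢0 k}}) per)

theorem4p2 : (a : ℕ → ℕ) → (∀ i → 0 < a i) →
    ((m : ℕ) → ¬ ¬ (∃ λ k → (m < k) × DensityAtMostTwoThirds a k))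
    × ((k : ℕ) → 1 ≤ k → ¬ DensityAtMostTwoThirds a k → DensityAtMostTwoThirds a (suc k))
theorem4p2 a pos = density-above , density-next
  where
  dichotomy : ∀ k → DensityAtMostTwoThirds a k ⊎ DensityAtMostTwoThirds a (suc k)
  dichotomy = density-dichotomy a (λ i → >-nonZero (pos i))
  density-above : (m : ℕ) → ¬ ¬ (∃ λ k → (m < k) × DensityAtMostTwoThirds a k)
  density-above m ¬density-above = ¬density-above
    ([ (λ D → suc m , ≤-refl , D) , (λ D → suc (suc m) , s≤s (n≤1+n m) , D) ]′ (dichotomy (suc m)))
  density-next : (k : ℕ) → 1 ≤ k → ¬ DensityAtMostTwoThirds a k → DensityAtMostTwoThirds a (suc k)
  -- The dichotomy holds for every k.
  density-next k _ ¬D = [ (λ D → contradiction D ¬D) , id ]′ (dichotomy k)
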